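{- If $X$ and $Y$ are directed acyclic graphs, each with $n$ vertices, then $\mathrm{DFS}(X,Y)$ is also acyclic (it contains no directed cycle).
   Context: For directed graphs $X,Y$ with $n$ vertices, $\mathrm{DFS}(X,Y)$ is the directed graph whose vertices are the bijections $\sigma:V(X)\to V(Y)$, with a directed edge from $\sigma$ to $\phi$ if and only if there exist distinct $a,b\in V(X)$ with $a\to b$ an edge of $X$, $\sigma(a)\to\sigma(b)$ an edge of $Y$, and $\phi=\sigma\circ(a\;b)$ (i.e. $\phi$ agrees with $\sigma$ except $\phi(a)=\sigma(b)$, $\phi(b)=\sigma(a)$). -}

module Defs where

open import Data.Nat using (ℕ)
open import Data.Fin using (Fin; _≟_)
open import Data.Product using (Σ; Σ-syntax; ∃₂; _×_)
open import Function.Definitions using (Bijective)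
open import Relation.Binary.PropositionalEquality using (_≡_; _≢_)
open import Relation.Binary.Construct.Closure.Transitive using (TransClosure)
open import Relation.Nullary using (¬_; yes; no)

Digraph : ℕ → Set₁
Digraph n = Fin n → Fin n → Set

swap : ∀ {n} → Fin n → Fin n → Fin n → Fin n
swap a b x with x ≟ a
... | yes _ = b
... | no _ with x ≟ b
...   | yes _ = a
...   | no _  = x

-- Bijections V(X) → V(Y) (both vertex sets are Fin n).
Bij : ℕ → Set
Bij n = Σ[ f ∈ (Fin n → Fin n) ] Bijective _≡_ _≡_ f

_≈B_ : ∀ {n} → Bij n → Bij n → Set
σ ≈B φ = ∀ x → Σ.proj₁ σ x ≡ Σ.proj₁ φ x

DFS : ∀ {n} → Digraph n → Digraph n → Bij n → Bij n → Set
DFS {n} X Y σ φ =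
  ∃₂ λ (a b : Fin n) → a ≢ b × X a b × Y (Σ.proj₁ σ a) (Σ.proj₁ σ b)
    × (∀ x → Σ.proj₁ φ x ≡ Σ.proj₁ σ (swap a b x))

Acyclic : ∀ {A : Set} → (A → A → Set) → (A → A → Set) → Set
Acyclic {A} _≈_ E = ∀ (u v : A) → TransClosure E u v → ¬ (v ≈ u)

AcyclicDigraph : ∀ {n} → Digraph n → Set
AcyclicDigraph X = Acyclic _≡_ X

{-# OPTIONS --safe #-}
-- Along a walk σ₀ → σ₁ → ⋯ → σₖ in DFS(X,Y), the i-th step exchanges the values
-- uᵢ = σᵢ aᵢ and vᵢ = σᵢ bᵢ, where uᵢ → vᵢ in Y: the value uᵢ is promoted along
-- the X-edge aᵢ → bᵢ, the value vᵢ is demoted back along it.  The exchanged pairs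
-- form a nonempty set of Y-edges, and Y is acyclic, hence well-founded; so some
-- value z is promoted at some step but never demoted.  The position of z then
-- only ever moves forward in X, at least once, so if the walk were closed those
-- positions would form a directed cycle in X.
module Submission where

open import Data.Nat using (ℕ)
open import Data.Fin using (Fin; _≟_)
open import Data.Fin.Induction using (spo-wellFounded)
open import Data.List using (List; []; _∷_; map)
open import Data.List.Membership.Propositional using (_∈_; _∉_)
open import Data.List.Membership.Propositional.Properties using (∈-map⁺; ∈-map⁻)
import Data.List.Membership.DecPropositional as DecMembership
open import Data.List.Relation.Unary.All as All using (All; []; _∷_)
open import Data.List.Relation.Unary.Any using (here; there)
open import Data.Product using (∃; _×_; _,_; proj₁; proj₂; uncurry)
open import Function.Base using (_∘_)
open import Induction.WellFounded using (WellFounded; Acc; acc)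
open import Level using (Level)
open import Relation.Binary.Core using (Rel)
open import Relation.Binary.Definitions using (DecidableEquality)
open import Relation.Binary.Structures using (IsStrictPartialOrder)
open import Relation.Binary.PropositionalEquality
open import Relation.Binary.Construct.Closure.ReflexiveTransitive using (Star; ε; _◅_; _◅◅_)
open import Relation.Binary.Construct.Closure.Transitive using (TransClosure; [_]; _∷_; _++_; wellFounded⁻)
open import Relation.Nullary using (yes; no; contradiction)

open import Defs

module _ {a ℓ : Level} {A : Set a} {R : Rel A ℓ} where

  _◅⁺_ : ∀ {x y z} → R x y → Star R y z → TransClosure R x z
  r ◅⁺ ε        = [ r ]
  r ◅⁺ (s ◅ rs) = r ∷ (s ◅⁺ rs)

  _◅◅⁺_ : ∀ {x y z} → Star R x y → TransClosure R y z → TransClosure R x z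
  ε        ◅◅⁺ rs = rs
  (r ◅ rs) ◅◅⁺ ts = r ∷ (rs ◅◅⁺ ts)

acyclic⇒isStrictPartialOrder : {A : Set} {E : Rel A _} → Acyclic _≡_ E →
                               IsStrictPartialOrder _≡_ (TransClosure E)
acyclic⇒isStrictPartialOrder acyclic = record
  { isEquivalence = isEquivalence
  ; irrefl        = λ x≡y x⁺y → acyclic _ _ x⁺y (sym x≡y)
  ; trans         = _++_
  ; <-resp-≈      = resp₂ _
  }

acyclic⇒wellFounded : ∀ {n} {X : Digraph n} → AcyclicDigraph X → WellFounded X
acyclic⇒wellFounded {X = X} =
  wellFounded⁻ X ∘ spo-wellFounded ∘ acyclic⇒isStrictPartialOrder

module _ {a ℓ : Level} {A : Set a} {R : Rel A ℓ} (_≟ᴬ_ : DecidableEquality A) where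

  open DecMembership _≟ᴬ_ using (_∈?_)

  IsSource : List (A × A) → A → Set a
  IsSource es z = z ∈ map proj₁ es × z ∉ map proj₂ es

  wellFounded⇒source : WellFounded R → ∀ es → All (uncurry R) es →
                       ∀ {u} → u ∈ map proj₁ es → ∃ (IsSource es)
  wellFounded⇒source wf es edges u∈ = descend (wf _) u∈
    where
    descend : ∀ {u} → Acc R u → u ∈ map proj₁ es → ∃ (IsSource es)
    descend {u} (acc smaller) u∈ with u ∈? map proj₂ es
    ... | no u∉ = u , u∈ , u∉
    ... | yes u∈₂ with ∈-map⁻ proj₂ u∈₂
    ...   | (w , _) , wu∈ , refl =
      descend (smaller (All.lookup edges wu∈)) (∈-map⁺ proj₁ wu∈)

module _ {n : ℕ} where

  swap-b≡a : {a b : Fin n} → a ≢ b → swap a b b ≡ a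
  swap-b≡a {a} {b} a≢b with b ≟ a
  ... | yes b≡a = contradiction (sym b≡a) a≢b
  ... | no _ with b ≟ b
  ...   | yes _  = refl
  ...   | no b≢b = contradiction refl b≢b

  swap-x≡x : {a b x : Fin n} → x ≢ a → x ≢ b → swap a b x ≡ x
  swap-x≡x {a} {b} {x} x≢a x≢b with x ≟ a
  ... | yes x≡a = contradiction x≡a x≢a
  ... | no _ with x ≟ b
  ...   | yes x≡b = contradiction x≡b x≢b
  ...   | no _ = refl

  injective : (σ : Bij n) → ∀ {x y} → proj₁ σ x ≡ proj₁ σ y → x ≡ y
  injective σ = proj₁ (proj₂ σ)

  preimage : (σ : Bij n) (y : Fin n) → ∃ λ x → proj₁ σ x ≡ y
  preimage σ y = let x , σx≡y = proj₂ (proj₂ σ) y in x , σx≡y refl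

module _ {n : ℕ} (X Y : Digraph n) where

  -- The bijectivity proofs inside σ and φ cannot be inferred from a step, so
  -- σ and φ are passed explicitly whenever a step is not matched on.
  promoted demoted : ∀ {σ φ} → DFS X Y σ φ → Fin n
  promoted {σ} (a , _)     = proj₁ σ a
  demoted  {σ} (_ , b , _) = proj₁ σ b

  exchanges : ∀ {σ τ} → TransClosure (DFS X Y) σ τ → List (Fin n × Fin n)
  exchanges ([_] {σ} {φ} e)   = (promoted {σ} {φ} e , demoted {σ} {φ} e) ∷ []
  exchanges (_∷_ {σ} {φ} e p) = (promoted {σ} {φ} e , demoted {σ} {φ} e) ∷ exchanges p

  exchanges-are-edges : ∀ {σ τ} (p : TransClosure (DFS X Y) σ τ) → All (uncurry Y) (exchanges p)
  exchanges-are-edges [ (_ , _ , _ , _ , y , _) ]   = y ∷ []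
  exchanges-are-edges ((_ , _ , _ , _ , y , _) ∷ p) = y ∷ exchanges-are-edges p

  some-promoted : ∀ {σ τ} (p : TransClosure (DFS X Y) σ τ) → ∃ (_∈ map proj₁ (exchanges p))
  some-promoted [ _ ]   = _ , here refl
  some-promoted (_ ∷ _) = _ , here refl

  promoted-moves-forward : ∀ {σ φ} (e : DFS X Y σ φ) {q} → proj₁ σ q ≡ promoted {σ} {φ} e →
                           ∃ λ q' → proj₁ φ q' ≡ promoted {σ} {φ} e × X q q'
  promoted-moves-forward {σ} (a , b , a≢b , x , _ , φ≗σ∘swap) σq≡σa
    with refl ← injective σ σq≡σa
    = b , trans (φ≗σ∘swap b) (cong (proj₁ σ) (swap-b≡a a≢b)) , x

  others-stay : ∀ {σ φ} (e : DFS X Y σ φ) {q} → proj₁ σ q ≢ promoted {σ} {φ} e →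
                proj₁ σ q ≢ demoted {σ} {φ} e → proj₁ φ q ≡ proj₁ σ q
  others-stay {σ} (a , b , _ , _ , _ , φ≗σ∘swap) {q} σq≢σa σq≢σb =
    trans (φ≗σ∘swap q) (cong (proj₁ σ) (swap-x≡x (σq≢σa ∘ cong (proj₁ σ)) (σq≢σb ∘ cong (proj₁ σ))))

  step-advances : ∀ {σ φ} (e : DFS X Y σ φ) {z q} → proj₁ σ q ≡ z → z ≢ demoted {σ} {φ} e →
                  ∃ λ q' → proj₁ φ q' ≡ z × Star X q q'
  step-advances {σ} {φ} e {z} σq≡z z≢v with z ≟ promoted {σ} {φ} e | σq≡z
  ... | yes refl | _    =
    let q' , φq'≡z , x = promoted-moves-forward {σ} {φ} e σq≡z in q' , φq'≡z , x ◅ ε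
  ... | no z≢u   | refl = _ , others-stay {σ} {φ} e z≢u z≢v , ε

  position-advances* : ∀ {σ τ} (p : TransClosure (DFS X Y) σ τ) {z q} → proj₁ σ q ≡ z →
                       z ∉ map proj₂ (exchanges p) → ∃ λ q' → proj₁ τ q' ≡ z × Star X q q'
  position-advances* ([_] {σ} {φ} e) σq≡z z∉ = step-advances {σ} {φ} e σq≡z (z∉ ∘ here)
  position-advances* (_∷_ {σ} {φ} e p) σq≡z z∉ =
    let q₁ , φq₁≡z , q*q₁ = step-advances {σ} {φ} e σq≡z (z∉ ∘ here)
        q' , τq'≡z , q₁*q' = position-advances* p φq₁≡z (z∉ ∘ there)
    in q' , τq'≡z , q*q₁ ◅◅ q₁*q'

  position-advances⁺ : ∀ {σ τ} (p : TransClosure (DFS X Y) σ τ) {z q} → proj₁ σ q ≡ z →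
                       z ∈ map proj₁ (exchanges p) → z ∉ map proj₂ (exchanges p) →
                       ∃ λ q' → proj₁ τ q' ≡ z × TransClosure X q q'
  position-advances⁺ ([_] {σ} {φ} e) σq≡z (here refl) _ =
    let q' , φq'≡z , x = promoted-moves-forward {σ} {φ} e σq≡z in q' , φq'≡z , [ x ]
  position-advances⁺ (_∷_ {σ} {φ} e p) σq≡z (here refl) z∉ =
    let q₁ , φq₁≡z , x = promoted-moves-forward {σ} {φ} e σq≡z
        q' , τq'≡z , q₁*q' = position-advances* p φq₁≡z (z∉ ∘ there)
    in q' , τq'≡z , x ◅⁺ q₁*q'
  position-advances⁺ (_∷_ {σ} {φ} e p) σq≡z (there z∈) z∉ =
    let q₁ , φq₁≡z , q*q₁ = step-advances {σ} {φ} e σq≡z (z∉ ∘ here)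
        q' , τq'≡z , q₁⁺q' = position-advances⁺ p φq₁≡z z∈ (z∉ ∘ there)
    in q' , τq'≡z , q*q₁ ◅◅⁺ q₁⁺q'

theorem3p5 : (n : ℕ) (X Y : Digraph n) → AcyclicDigraph X → AcyclicDigraph Y
    → Acyclic _≈B_ (DFS X Y)
theorem3p5 n X Y acyclicX acyclicY σ τ p τ≈σ =
  let u , u∈ = some-promoted X Y p
      z , z∈ , z∉ = wellFounded⇒source _≟_ (acyclic⇒wellFounded acyclicY)
                      (exchanges X Y p) (exchanges-are-edges X Y p) u∈
      q , σq≡z = preimage σ z
      q' , τq'≡z , q⁺q' = position-advances⁺ X Y p σq≡z z∈ z∉
  in acyclicX q q' q⁺q' (injective σ (trans (sym (τ≈σ q')) (trans τq'≡z (sym σq≡z))))
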